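{- Let $I$ be a finite index set, let $\sigma$ be a counter $I$-signature, let $G$ be a graph and let $\mathcal{I}$ be a $G$-interpretation of $\sigma$. For any $X\subseteq V(G)$ and $I$-tuples $A_I$ and $A'_I$ of subsets of $V(G)$, if $A_I\setminus X=A'_I\setminus X$, then $\gamma(\mathcal{I},A_I,v)=\gamma(\mathcal{I},A'_I,v)$ for every counter symbol $\gamma$ of $\sigma$ and every $v\in V(G)\setminus h_{\mathcal{I}}(X)$.
   Context: An $I$-tuple of subsets of $S$ is $A_I=\{A_i:i\in I\}$, $A_i\subseteq S$; $A_I\setminus X=\{A_i\setminus X\}$. A term is a variable or a composition of unary function symbols applied to a variable. A counter $I$-signature $\sigma$ consists of unary predicate symbols, unary function symbols, and linearly ordered counter symbols $\gamma_1<\dots<\gamma_{\ell(\sigma)}$, each with a trigger $(f,\theta)$: $f$ is a unary function symbol of $\sigma$ and $\theta$ is a quantifier-free formula with the single variable $x$, using no function symbols, built from the predicates $X_i$ ($i\in I$), the predicate symbols of $\sigma$, equality, and atomic formulas $\gamma'(x)\ge m$ with $\gamma'$ strictly smaller than $\gamma$ and $m$ a positive integer. For a graph $G$, a $G$-interpretation $\mathcal{I}$ of $\sigma$ assigns a subset of $V(G)$ to each predicate symbol and to each function symbol $f$ a function $f_{\mathcal{I}}:V(G)\to V(G)$ with $f_{\mathcal{I}}(v)=v$ or $f_{\mathcal{I}}(v)$ adjacent to $v$ for each $v$. For an $I$-tuple $A_I$ (interpreting $X_i$ as $A_i$), counter values are defined in order: if $\gamma$ has trigger $(f,\theta)$,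 $\gamma(\mathcal{I},A_I,v)$ is the number of $u\in V(G)\setminus\{v\}$ with $f_{\mathcal{I}}(u)=v$ and $\theta(u)$ true. For $i=1,\dots,\ell(\sigma)$ let $f_{i,\mathcal{I}}$ be the interpretation of the function symbol in the trigger of $\gamma_i$; set $h_{0,\mathcal{I}}(v)=\{v\}$, $h_{i,\mathcal{I}}(v)=h_{i-1,\mathcal{I}}(v)\cup\{f_{i,\mathcal{I}}(u):u\in h_{i-1,\mathcal{I}}(v)\}$, $h_{\mathcal{I}}=h_{\ell(\sigma),\mathcal{I}}$, and $h_{\mathcal{I}}(X)=\bigcup_{v\in X}h_{\mathcal{I}}(v)$. -}

module Defs where

open import Data.Nat using (ℕ; zero; suc; _≤_; _≤ᵇ_)
open import Data.Fin using (Fin; zero; suc)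
open import Data.Fin.Properties using () renaming (_≟_ to _≟ᶠ_)
open import Data.Fin.Subset using (Subset)
open import Data.Vec using (lookup)
open import Data.Bool using (Bool; true; false; not; _∧_; _∨_)
open import Data.List using (length; filterᵇ; allFin)
open import Data.Product using (Σ; _×_; _,_; ∃)
open import Data.Sum using (_⊎_)
open import Relation.Binary.PropositionalEquality using (_≡_)
open import Relation.Nullary using (¬_; ⌊_⌋)

record Graph (n : ℕ) : Set₁ where
  field
    Adj       : Fin n → Fin n → Set
    Adj-sym   : ∀ {u v} → Adj u v → Adj v u
    Adj-irrefl : ∀ {v} → ¬ Adj v v

-- Quantifier-free formulas in the single variable x, without function
-- symbols, over: the predicates X_i (i ∈ I = Fin k), the predicate symbols
-- Fin p of the signature, equality (the only equality atom in one variable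
-- and no function symbols is x = x), and counter atoms γ'(x) ≥ m with m ≥ 1,
-- where γ' ranges over the c counters that are available (strictly smaller).
data Formula (k p c : ℕ) : Set where
  atomX   : Fin k → Formula k p c
  atomP   : Fin p → Formula k p c
  atomEq  : Formula k p c
  atomCnt : Fin c → (m : ℕ) → 1 ≤ m → Formula k p c
  fTrue   : Formula k p c
  fFalse  : Formula k p c
  fNot    : Formula k p c → Formula k p c
  fAnd    : Formula k p c → Formula k p c → Formula k p c
  fOr     : Formula k p c → Formula k p c → Formula k p c

-- The triggers of the linearly ordered counters γ_1 < ... < γ_c, given as a
-- snoc-list: the trigger (f , θ) of the newest (largest) counter may only
-- use the counters that were introduced before it.
-- Indexing convention: a counter of a signature with c counters is an
-- element of Fin c, where zero denotes the LARGEST counter γ_c,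
-- suc zero denotes γ_{c-1}, etc.
data Triggers (k p q : ℕ) : ℕ → Set where
  []  : Triggers k p q 0
  _▷_ : ∀ {c} → Triggers k p q c → Fin q × Formula k p c → Triggers k p q (suc c)

record Signature (k : ℕ) : Set where
  field
    p q ℓ    : ℕ
    triggers : Triggers k p q ℓ
open Signature public

record Interpretation {k n : ℕ} (σ : Signature k) (G : Graph n) : Set where
  field
    predI : Fin (p σ) → Subset n
    funI  : Fin (q σ) → Fin n → Fin n
    funI-ok : ∀ f v → funI f v ≡ v ⊎ Graph.Adj G v (funI f v)
open Interpretation public

countV : ∀ {n} → (Fin n → Bool) → ℕ
countV {n} P = length (filterᵇ P (allFin n))

module _ {n k p q : ℕ}
         (predI : Fin p → Subset n) (funI : Fin q → Fin n → Fin n)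
         (A : Fin k → Subset n) where

  evalF : ∀ {c} → Formula k p c → (Fin c → Fin n → ℕ) → Fin n → Bool
  evalF (atomX i)       cv x = lookup (A i) x
  evalF (atomP P)       cv x = lookup (predI P) x
  evalF atomEq          cv x = ⌊ x ≟ᶠ x ⌋
  evalF (atomCnt j m _) cv x = m ≤ᵇ cv j x
  evalF fTrue           cv x = true
  evalF fFalse          cv x = false
  evalF (fNot φ)        cv x = not (evalF φ cv x)
  evalF (fAnd φ ψ)      cv x = evalF φ cv x ∧ evalF ψ cv x
  evalF (fOr φ ψ)       cv x = evalF φ cv x ∨ evalF ψ cv x

  counterVal : ∀ {c} → Triggers k p q c → Fin c → Fin n → ℕ
  counterVal (ts ▷ (f , θ)) zero v =
    countV (λ u → not ⌊ u ≟ᶠ v ⌋ ∧ ⌊ funI f u ≟ᶠ v ⌋ ∧ evalF θ (counterVal ts) u)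
  counterVal (ts ▷ _) (suc j) v = counterVal ts j v

module _ {n q : ℕ} (funI : Fin q → Fin n → Fin n) where

  InH : ∀ {k p c} → Triggers k p q c → Fin n → Fin n → Set
  InH []             v w = w ≡ v
  InH (ts ▷ (f , _)) v w = InH ts v w ⊎ ∃ λ u → InH ts v u × funI f u ≡ w

module _ {k n : ℕ} {σ : Signature k} {G : Graph n} where

  γval : Interpretation σ G → (Fin k → Subset n) → Fin (ℓ σ) → Fin n → ℕ
  γval 𝓘 A = counterVal (predI 𝓘) (funI 𝓘) A (triggers σ)

  InHSet : Interpretation σ G → Subset n → Fin n → Set
  InHSet 𝓘 X w = Σ (Fin n) λ x → lookup X x ≡ true × InH (funI 𝓘) (triggers σ) x w

module Submission where

open import Defs
open import Data.Nat using (ℕ; _≤ᵇ_)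
open import Data.Fin using (Fin; zero; suc)
open import Data.Fin.Properties using () renaming (_≟_ to _≟ᶠ_)
open import Data.Fin.Subset using (Subset; _─_)
open import Data.Vec using (lookup; _∷_)
open import Data.Bool using (Bool; true; false; not; _∧_; _∨_; T; T?)
open import Data.List using (length; allFin)
open import Data.List.Properties using (filter-≐)
open import Data.Product using (Σ; _×_; _,_)
open import Data.Sum using (inj₁; inj₂)
open import Function using (_∘_)
open import Relation.Binary.PropositionalEquality using (_≡_; refl; sym; trans; cong; cong₂; subst)
open import Relation.Nullary using (¬_; ⌊_⌋; yes; no)

-- The counter at v only inspects the vertices u with f(u) = v, and, through
-- its trigger, the tuple and the smaller counters at such u. If v lies
-- outside h(X), each such u lies outside the h-set of the smaller counters,
-- in particular outside X, where the two tuples agree; so induction along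
-- the counters shows that both tuples give the same counts.

countV-cong : ∀ {n} {P Q : Fin n → Bool} → (∀ u → P u ≡ Q u) → countV P ≡ countV Q
countV-cong {n} {P} {Q} P≗Q =
  cong length (filter-≐ (T? ∘ P) (T? ∘ Q)
    ((λ {u} → subst T (P≗Q u)) , (λ {u} → subst T (sym (P≗Q u)))) (allFin n))

lookup-─-∉ : ∀ {n} (S Y : Subset n) u → lookup Y u ≡ false → lookup (S ─ Y) u ≡ lookup S u
lookup-─-∉ (s ∷ S) (false ∷ Y) zero    refl = refl
lookup-─-∉ (s ∷ S) (y ∷ Y)     (suc u) u∉Y  = lookup-─-∉ S Y u u∉Y

module _ {n k p q : ℕ} (predI : Fin p → Subset n) (funI : Fin q → Fin n → Fin n) where

  evalF-cong : ∀ {c} (φ : Formula k p c) {A A′ : Fin k → Subset n}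
               {cv cv′ : Fin c → Fin n → ℕ} {u : Fin n} →
               (∀ i → lookup (A i) u ≡ lookup (A′ i) u) → (∀ j → cv j u ≡ cv′ j u) →
               evalF predI funI A φ cv u ≡ evalF predI funI A′ φ cv′ u
  evalF-cong (atomX i)       A≡ cv≡ = A≡ i
  evalF-cong (atomP P)       A≡ cv≡ = refl
  evalF-cong atomEq          A≡ cv≡ = refl
  evalF-cong (atomCnt j m _) A≡ cv≡ = cong (m ≤ᵇ_) (cv≡ j)
  evalF-cong fTrue           A≡ cv≡ = refl
  evalF-cong fFalse          A≡ cv≡ = refl
  evalF-cong (fNot φ)        A≡ cv≡ = cong not (evalF-cong φ A≡ cv≡)
  evalF-cong (fAnd φ ψ)      A≡ cv≡ = cong₂ _∧_ (evalF-cong φ A≡ cv≡) (evalF-cong ψ A≡ cv≡)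
  evalF-cong (fOr φ ψ)       A≡ cv≡ = cong₂ _∨_ (evalF-cong φ A≡ cv≡) (evalF-cong ψ A≡ cv≡)

  InH-refl : ∀ {c} (ts : Triggers k p q c) v → InH funI ts v v
  InH-refl []       v = refl
  InH-refl (ts ▷ _) v = inj₁ (InH-refl ts v)

  module _ (X : Subset n) where

    InHX : ∀ {c} → Triggers k p q c → Fin n → Set
    InHX ts w = Σ (Fin n) λ x → lookup X x ≡ true × InH funI ts x w

    ∉InHX⇒∉X : ∀ {c} (ts : Triggers k p q c) {u} → ¬ InHX ts u → lookup X u ≡ false
    ∉InHX⇒∉X ts {u} u∉h with lookup X u in u∈X
    ... | true  with () ← u∉h (u , u∈X , InH-refl ts u)
    ... | false = refl

    ∉InHX-▷ : ∀ {c} {ts : Triggers k p q c} {t : Fin q × Formula k p c} {v} → ¬ InHX (ts ▷ t) v → ¬ InHX ts v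
    ∉InHX-▷ v∉h (x , x∈X , x↝v) = v∉h (x , x∈X , inj₁ x↝v)

    ∉InHX-preimage : ∀ {c} {ts : Triggers k p q c} {f} {θ : Formula k p c} {u v} →
                     ¬ InHX (ts ▷ (f , θ)) v → funI f u ≡ v → ¬ InHX ts u
    ∉InHX-preimage {u = u} v∉h fu≡v (x , x∈X , x↝u) = v∉h (x , x∈X , inj₂ (u , x↝u , fu≡v))

    module _ (A A′ : Fin k → Subset n) (A≡A′ : ∀ i → A i ─ X ≡ A′ i ─ X) where

      agree-outside : ∀ {u} → lookup X u ≡ false → ∀ i → lookup (A i) u ≡ lookup (A′ i) u
      agree-outside {u} u∉X i =
        trans (sym (lookup-─-∉ (A i) X u u∉X))
          (trans (cong (λ S → lookup S u) (A≡A′ i)) (lookup-─-∉ (A′ i) X u u∉X))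

      counterVal-agree : ∀ {c} (ts : Triggers k p q c) {v} → ¬ InHX ts v →
                         ∀ j → counterVal predI funI A ts j v ≡ counterVal predI funI A′ ts j v
      counterVal-agree (ts ▷ t) v∉h (suc j) = counterVal-agree ts (∉InHX-▷ {t = t} v∉h) j
      counterVal-agree (ts ▷ (f , θ)) {v} v∉h zero = countV-cong triggered-agree
        where
        triggered-agree : ∀ u →
          (not ⌊ u ≟ᶠ v ⌋ ∧ ⌊ funI f u ≟ᶠ v ⌋ ∧ evalF predI funI A θ (counterVal predI funI A ts) u)
          ≡ (not ⌊ u ≟ᶠ v ⌋ ∧ ⌊ funI f u ≟ᶠ v ⌋ ∧ evalF predI funI A′ θ (counterVal predI funI A′ ts) u)
        triggered-agree u with funI f u ≟ᶠ v
        ... | no _     = refl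
        ... | yes fu≡v = cong (not ⌊ u ≟ᶠ v ⌋ ∧_)
                (evalF-cong θ (agree-outside (∉InHX⇒∉X ts u∉h)) (counterVal-agree ts u∉h))
          where
          u∉h : ¬ InHX ts u
          u∉h = ∉InHX-preimage {θ = θ} v∉h fu≡v

lemma14 : ∀ {k n : ℕ} (σ : Signature k) (G : Graph n) (𝓘 : Interpretation σ G)
            (X : Subset n) (A A′ : Fin k → Subset n) →
            (∀ i → A i ─ X ≡ A′ i ─ X) →
            ∀ (γ : Fin (ℓ σ)) (v : Fin n) → ¬ InHSet 𝓘 X v →
            γval 𝓘 A γ v ≡ γval 𝓘 A′ γ v
lemma14 σ G 𝓘 X A A′ A≡A′ γ v v∉h =
  counterVal-agree (predI 𝓘) (funI 𝓘) X A A′ A≡A′ (triggers σ) v∉h γ
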